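{- Let $u,v\in D_n$ be such that $AD(u,v)\neq\emptyset$, let $t$ be a minimal element of $AD(u,v)$ with respect to $\preceq$, and let $r\in D(t)\setminus\{t\}$. Then $$r\in A(u)\iff r\in A(v)\iff r^t\in D(v)\iff r^t\in D(u),$$ where $r^t=trt$.
   Context: $D_n$ is the group of signed permutations $w$ of $\{\pm1,\dots,\pm n\}$ (with $w(-i)=-w(i)$) having an even number of negative entries among $w(1),\dots,w(n)$, written in window notation $[w(1),\dots,w(n)]$. Its reflections are $s_{i,j}$ (swap positions $i,j$) and $t_{i,j}$ (replace $i,j$ by $-j,-i$), $1\le i<j\le n$, and $S=\{s_{i,i+1}:1\le i\le n-1\}\cup\{t_{1,2}\}$. Acting on $\mathbb R^n$, the positive root of $s_{i,j}$ is $\alpha_{i,j}=e_i-e_j$ and that of $t_{i,j}$ is $\beta_{i,j}=-e_i-e_j$; the simple roots are $\alpha_{k,k+1}$ and $\beta_{1,2}$. For reflections $r,t$: $r\preceq t$ iff (positive root of $t$) $-$ (positive root of $r$) is a nonnegative combination of simple roots. $D(w)=\{t\in T: wt<w\}$, $A(w)=\{t\in T: w<wt\}$ (Bruhat order), $AD(u,v)=A(u)\cap D(v)$; concretely $s_{i,j}\in D(w)$ iff $w(i)>w(j)$ and $t_{i,j}\in D(w)$ iff $w(i)+w(j)<0$. -}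

module Defs where

open import Data.Nat as ℕ using (ℕ; zero; suc; _%_)
open import Data.Integer as ℤ using (ℤ; +_; -[1+_]; _+_; _*_; -_; ∣_∣)
open import Data.Fin as Fin using (Fin; toℕ; fromℕ<)
open import Data.Vec using (Vec; []; _∷_; lookup; tabulate; map; zipWith; replicate)
open import Data.List using (List; []; _∷_)
open import Data.List.Relation.Unary.All using (All)
open import Data.Product using (Σ; _×_; _,_; proj₁; proj₂)
open import Data.Sum using (_⊎_)
open import Data.Bool using (if_then_else_)
open import Relation.Binary.PropositionalEquality using (_≡_)
open import Relation.Nullary using (¬_; does)

-- Signed permutations are represented by their window [w(1),...,w(n)]
-- (positions indexed by Fin n, i.e. 0-based; values are nonzero integers in 1..n up to sign).

Window : ℕ → Set
Window n = Vec ℤ n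

negs : ∀ {n} → Window n → ℕ
negs [] = 0
negs (+ _ ∷ w) = negs w
negs (-[1+ _ ] ∷ w) = suc (negs w)

InDn : (n : ℕ) → Window n → Set
InDn n w =
  (∀ i → 1 ℕ.≤ ∣ lookup w i ∣ × ∣ lookup w i ∣ ℕ.≤ n)
  × (∀ i j → ∣ lookup w i ∣ ≡ ∣ lookup w j ∣ → i ≡ j)
  × (negs w % 2 ≡ 0)

-- evaluate w at a signed value k ∈ {±1,…,±n}, using w(-k) = -w(k)
evalW : ∀ {n} → Window n → ℤ → ℤ
evalW {n} w (+ zero) = + 0
evalW {n} w (+ suc m) with m ℕ.<? n
... | Relation.Nullary.yes p = lookup w (fromℕ< p)
... | Relation.Nullary.no _ = + 0
evalW {n} w -[1+ m ] with m ℕ.<? n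
... | Relation.Nullary.yes p = - lookup w (fromℕ< p)
... | Relation.Nullary.no _ = + 0

_·_ : ∀ {n} → Window n → Window n → Window n
u · v = map (evalW u) v

data Refl (n : ℕ) : Set where
  s : (i j : Fin n) → i Fin.< j → Refl n
  t : (i j : Fin n) → i Fin.< j → Refl n

pos : ∀ {n} → Fin n → ℤ
pos k = + suc (toℕ k)

perm : ∀ {n} → Refl n → Window n
perm (s i j _) = tabulate λ k →
  if does (k Fin.≟ i) then pos j else if does (k Fin.≟ j) then pos i else pos k
perm (t i j _) = tabulate λ k →
  if does (k Fin.≟ i) then - pos j else if does (k Fin.≟ j) then - pos i else pos k

conj : ∀ {n} → Refl n → Refl n → Window n
conj r τ = perm τ · (perm r · perm τ)

-- descent / ascent conditions (concrete description of D(w), A(w))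
-- s_{i,j} ∈ D(w) iff w(i) > w(j);  t_{i,j} ∈ D(w) iff w(i)+w(j) < 0
Des : ∀ {n} → Window n → Refl n → Set
Des w (s i j _) = lookup w j ℤ.< lookup w i
Des w (t i j _) = lookup w i + lookup w j ℤ.< + 0

Asc : ∀ {n} → Window n → Refl n → Set
Asc w (s i j _) = lookup w i ℤ.< lookup w j
Asc w (t i j _) = + 0 ℤ.< lookup w i + lookup w j

InD : ∀ {n} → Window n → Window n → Set
InD {n} w x = Σ (Refl n) λ ρ → perm ρ ≡ x × Des w ρ

InAD : ∀ {n} → Window n → Window n → Refl n → Set
InAD u v ρ = Asc u ρ × Des v ρ

-- roots in ℝ^n (integer coordinates)
e : ∀ {n} → Fin n → Vec ℤ n
e i = tabulate λ k → if does (k Fin.≟ i) then + 1 else + 0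

_⊕_ : ∀ {n} → Vec ℤ n → Vec ℤ n → Vec ℤ n
_⊕_ = zipWith _+_

⊖_ : ∀ {n} → Vec ℤ n → Vec ℤ n
⊖_ = map -_

root : ∀ {n} → Refl n → Vec ℤ n
root (s i j _) = e i ⊕ (⊖ e j)
root (t i j _) = (⊖ e i) ⊕ (⊖ e j)

-- simple reflections: s_{k,k+1} and t_{1,2}
Simple : ∀ {n} → Refl n → Set
Simple (s i j _) = toℕ j ≡ suc (toℕ i)
Simple (t i j _) = toℕ i ≡ 0 × toℕ j ≡ 1

lincomb : ∀ {n} → List (ℕ × Refl n) → Vec ℤ n
lincomb [] = replicate _ (+ 0)
lincomb ((c , ρ) ∷ cs) = map (λ x → + c * x) (root ρ) ⊕ lincomb cs

-- r ⪯ τ iff root(τ) - root(r) is a nonnegative combination of simple roots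
-- (nonnegative real coefficients can be taken integral, since roots are integral
--  and simple roots form a basis over the integers of the root lattice)
_⪯_ : ∀ {n} → Refl n → Refl n → Set
_⪯_ {n} r τ = Σ (List (ℕ × Refl n)) λ cs →
  All (λ p → Simple (proj₂ p)) cs × (root τ ⊕ (⊖ root r) ≡ lincomb cs)

MinimalAD : ∀ {n} → Window n → Window n → Refl n → Set
MinimalAD {n} u v τ = InAD u v τ × (∀ (ρ : Refl n) → InAD u v ρ → ρ ⪯ τ → ρ ≡ τ)

{-# OPTIONS --safe #-}
module Submission where

-- Put r′ = r^τ. For a descent r ≠ τ of τ, a case analysis on how the indices of r meet those
-- of τ shows that r′ is a reflection and that the roots satisfy α_τ = α_r + α_r′. As every
-- positive root is a nonnegative combination of simple roots, both r and r′ are ⪯ τ, so by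
-- minimality neither lies in AD(u,v). A reflection ρ is an ascent (descent) of a window w
-- exactly when ⟨w, −α_ρ⟩ is positive (negative), and for w ∈ D_n this number is never zero.
-- Additivity of the roots then closes the cycle
--   r ∈ A(u) ⇒ r ∈ A(v) ⇒ r′ ∈ D(v) ⇒ r′ ∈ D(u) ⇒ r ∈ A(u),
-- whose first and third steps use r, r′ ∉ AD(u,v), and whose second and fourth use
-- τ ∈ D(v) and τ ∈ A(u).

open import Defs
open import Data.Nat as ℕ using (ℕ; zero; suc; z≤n; s≤s)
import Data.Nat.Properties as ℕP
open import Data.Integer as ℤ using (ℤ; +_; 0ℤ; _+_; _*_; _-_; -_; ∣_∣; _<_)
import Data.Integer.Properties as ℤP
open import Data.Integer.Tactic.RingSolver using (solve-∀)
open import Data.Fin as Fin using (Fin; toℕ; fromℕ<)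
open import Data.Fin.Patterns using (0F; 1F)
import Data.Fin.Properties as FinP
open import Data.Vec using (Vec; lookup; tabulate; map)
open import Data.Vec.Properties
  using (lookup∘tabulate; lookup-map; lookup-zipWith; lookup-replicate; tabulate∘lookup; tabulate-cong)
open import Data.List using (List; []; _∷_; _++_)
open import Data.List.Relation.Unary.All using (All; []; _∷_)
open import Data.List.Relation.Unary.All.Properties using (++⁺)
open import Data.Product using (Σ; ∃; _×_; _,_; proj₂)
open import Data.Sum using (_⊎_; inj₁; inj₂; [_,_]′)
open import Data.Empty using (⊥-elim)
open import Data.Bool using (if_then_else_)
open import Function using (_∘_; id)
open import Function.Bundles using (_⇔_; mk⇔; module Equivalence)
import Function.Properties.Equivalence as ⇔
open import Relation.Binary.PropositionalEquality
open import Relation.Binary.Definitions using (tri<; tri≈; tri>)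
open import Relation.Nullary using (¬_; does; yes; no)
open import Relation.Nullary.Decidable using (dec-true; dec-false)

private variable
  n : ℕ
  x y : ℤ

pos-injective : {i j : Fin n} → pos i ≡ pos j → i ≡ j
pos-injective = FinP.toℕ-injective ∘ ℤP.+[1+-injective

pos-cancel-< : {i j : Fin n} → pos i < pos j → i Fin.< j
pos-cancel-< = ℕ.s<s⁻¹ ∘ ℤP.drop‿+<+

>⇒≢ : {i j : Fin n} → i Fin.< j → j ≢ i
>⇒≢ = ≢-sym ∘ FinP.<⇒≢

[x-y]+y≡x : ∀ x y → x - y + y ≡ x
[x-y]+y≡x = solve-∀

x<y⇔0<y-x : x < y ⇔ 0ℤ < y - x
x<y⇔0<y-x {x} {y} = mk⇔
  (λ x<y → subst (_< y - x) (ℤP.+-inverseʳ x) (ℤP.+-monoˡ-< (- x) x<y))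
  (λ 0<y-x → subst₂ _<_ (ℤP.+-identityˡ x) ([x-y]+y≡x y x) (ℤP.+-monoˡ-< x 0<y-x))

x<y⇔x-y<0 : x < y ⇔ x - y < 0ℤ
x<y⇔x-y<0 {x} {y} = mk⇔
  (λ x<y → subst (x - y <_) (ℤP.+-inverseʳ y) (ℤP.+-monoˡ-< (- y) x<y))
  (λ x-y<0 → subst₂ _<_ ([x-y]+y≡x x y) (ℤP.+-identityˡ y) (ℤP.+-monoˡ-< y x-y<0))

pos-pos<0⇒< : {i j : Fin n} → pos i - pos j < 0ℤ → i Fin.< j
pos-pos<0⇒< = pos-cancel-< ∘ Equivalence.from x<y⇔x-y<0

-pos+pos<0⇒> : {i j : Fin n} → - pos j + pos i < 0ℤ → i Fin.< j
-pos+pos<0⇒> {i = i} {j} = pos-pos<0⇒< ∘ subst (_< 0ℤ) (ℤP.+-comm (- pos j) (pos i))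

0<x+y⇒y<0⇒0<x : 0ℤ < x + y → y < 0ℤ → 0ℤ < x
0<x+y⇒y<0⇒0<x {x} {y} 0<x+y y<0 =
  ℤP.<-trans 0<x+y (subst (x + y <_) (ℤP.+-identityʳ x) (ℤP.+-monoʳ-< x y<0))

x+y<0⇒0<x⇒y<0 : x + y < 0ℤ → 0ℤ < x → y < 0ℤ
x+y<0⇒0<x⇒y<0 {x} {y} x+y<0 0<x =
  ℤP.<-trans (subst (_< x + y) (ℤP.+-identityˡ y) (ℤP.+-monoˡ-< y 0<x)) x+y<0

x+y≡0⇒∣x∣≡∣y∣ : ∀ x y → x + y ≡ 0ℤ → ∣ x ∣ ≡ ∣ y ∣
x+y≡0⇒∣x∣≡∣y∣ x y x+y≡0 = trans (cong ∣_∣ x≡-y) (ℤP.∣-i∣≡∣i∣ y)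
  where
  x≡-y : x ≡ - y
  x≡-y = ℤP.i-j≡0⇒i≡j x (- y) (trans (cong (_+_ x) (ℤP.neg-involutive y)) x+y≡0)

lookup-ext : {xs ys : Vec ℤ n} → (∀ m → lookup xs m ≡ lookup ys m) → xs ≡ ys
lookup-ext {xs = xs} {ys} eq =
  trans (sym (tabulate∘lookup xs)) (trans (tabulate-cong eq) (tabulate∘lookup ys))

cover₃ : (P : Fin n → Set) (k a b : Fin n) → P k → P a → P b →
         (∀ m → m ≢ k → m ≢ a → m ≢ b → P m) → ∀ m → P m
cover₃ P k a b Pk Pa Pb Pelse m with m Fin.≟ k | m Fin.≟ a | m Fin.≟ b
... | yes refl | _        | _        = Pk
... | no _     | yes refl | _        = Pa
... | no _     | no _     | yes refl = Pb
... | no m≢k   | no m≢a   | no m≢b   = Pelse m m≢k m≢a m≢b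

-- perm (s a b _) and perm (t a b _) are, definitionally, tabulate (switch a b (pos b) (pos a))
-- and tabulate (switch a b (- pos b) (- pos a)).
switch : Fin n → Fin n → ℤ → ℤ → Fin n → ℤ
switch a b x y m = if does (m Fin.≟ a) then x else if does (m Fin.≟ b) then y else pos m

data SwitchView (a b : Fin n) (x y : ℤ) : Fin n → ℤ → Set where
  at₁       : SwitchView a b x y a x
  at₂       : SwitchView a b x y b y
  elsewhere : {m : Fin n} → m ≢ a → m ≢ b → SwitchView a b x y m (pos m)

switch-view : {a b : Fin n} {x y : ℤ} (m : Fin n) →
              SwitchView a b x y m (lookup (tabulate (switch a b x y)) m)
switch-view {a = a} {b} {x} {y} m rewrite lookup∘tabulate (switch a b x y) m with m Fin.≟ a
... | yes refl = at₁
... | no m≢a with m Fin.≟ b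
...   | yes refl = at₂
...   | no m≢b = elsewhere m≢a m≢b

module _ (a b : Fin n) (x y : ℤ) where

  lookup-switch₁ : lookup (tabulate (switch a b x y)) a ≡ x
  lookup-switch₁ rewrite lookup∘tabulate (switch a b x y) a | dec-true (a Fin.≟ a) refl = refl

  lookup-switch₂ : b ≢ a → lookup (tabulate (switch a b x y)) b ≡ y
  lookup-switch₂ b≢a rewrite lookup∘tabulate (switch a b x y) b
    | dec-false (b Fin.≟ a) b≢a | dec-true (b Fin.≟ b) refl = refl

  lookup-switch-elsewhere : {m : Fin n} → m ≢ a → m ≢ b → lookup (tabulate (switch a b x y)) m ≡ pos m
  lookup-switch-elsewhere {m} m≢a m≢b rewrite lookup∘tabulate (switch a b x y) m
    | dec-false (m Fin.≟ a) m≢a | dec-false (m Fin.≟ b) m≢b = refl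

module _ {a b : Fin n} (a<b : a Fin.< b) where

  s-view : ∀ m → SwitchView a b (pos b) (pos a) m (lookup (perm (s a b a<b)) m)
  s-view = switch-view

  t-view : ∀ m → SwitchView a b (- pos b) (- pos a) m (lookup (perm (t a b a<b)) m)
  t-view = switch-view

  s-at₁ : lookup (perm (s a b a<b)) a ≡ pos b
  s-at₁ = lookup-switch₁ a b (pos b) (pos a)

  s-at₂ : lookup (perm (s a b a<b)) b ≡ pos a
  s-at₂ = lookup-switch₂ a b (pos b) (pos a) (>⇒≢ a<b)

  s-elsewhere : {m : Fin n} → m ≢ a → m ≢ b → lookup (perm (s a b a<b)) m ≡ pos m
  s-elsewhere = lookup-switch-elsewhere a b (pos b) (pos a)

  t-at₁ : lookup (perm (t a b a<b)) a ≡ - pos b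
  t-at₁ = lookup-switch₁ a b (- pos b) (- pos a)

  t-at₂ : lookup (perm (t a b a<b)) b ≡ - pos a
  t-at₂ = lookup-switch₂ a b (- pos b) (- pos a) (>⇒≢ a<b)

  t-elsewhere : {m : Fin n} → m ≢ a → m ≢ b → lookup (perm (t a b a<b)) m ≡ pos m
  t-elsewhere = lookup-switch-elsewhere a b (- pos b) (- pos a)

first : Refl n → Fin n
first (s a _ _) = a
first (t a _ _) = a

image : Refl n → ℤ
image (s _ b _) = pos b
image (t _ b _) = - pos b

lookup-first : (ρ : Refl n) → lookup (perm ρ) (first ρ) ≡ image ρ
lookup-first (s a b a<b) = s-at₁ a<b
lookup-first (t a b a<b) = t-at₁ a<b

moves-first : (ρ : Refl n) → lookup (perm ρ) (first ρ) ≢ pos (first ρ)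
moves-first (s a b a<b) eq = >⇒≢ a<b (pos-injective (trans (sym (s-at₁ a<b)) eq))
moves-first (t a b a<b) eq with trans (sym (t-at₁ a<b)) eq
... | ()

fixes-below-first : (ρ : Refl n) {m : Fin n} → m Fin.< first ρ → lookup (perm ρ) m ≡ pos m
fixes-below-first (s a b a<b) m<a = s-elsewhere a<b (FinP.<⇒≢ m<a) (FinP.<⇒≢ (FinP.<-trans m<a a<b))
fixes-below-first (t a b a<b) m<a = t-elsewhere a<b (FinP.<⇒≢ m<a) (FinP.<⇒≢ (FinP.<-trans m<a a<b))

perm-determines-first : (ρ ρ′ : Refl n) → perm ρ ≡ perm ρ′ → first ρ ≡ first ρ′
perm-determines-first ρ ρ′ eq with FinP.<-cmp (first ρ) (first ρ′)
... | tri< f<f′ _ _ = ⊥-elim (moves-first ρ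
        (trans (cong (λ w → lookup w (first ρ)) eq) (fixes-below-first ρ′ f<f′)))
... | tri≈ _ f≡f′ _ = f≡f′
... | tri> _ _ f′<f = ⊥-elim (moves-first ρ′
        (trans (cong (λ w → lookup w (first ρ′)) (sym eq)) (fixes-below-first ρ f′<f)))

first-and-image-determine : (ρ ρ′ : Refl n) → first ρ ≡ first ρ′ → image ρ ≡ image ρ′ → ρ ≡ ρ′
first-and-image-determine (s a b p) (s .a b′ p′) refl eq with pos-injective eq
... | refl = cong (s a b) (FinP.<-irrelevant p p′)
first-and-image-determine (t a b p) (t .a b′ p′) refl eq with pos-injective (ℤP.neg-injective eq)
... | refl = cong (t a b) (FinP.<-irrelevant p p′)
first-and-image-determine (s a b p) (t .a b′ p′) refl ()
first-and-image-determine (t a b p) (s .a b′ p′) refl ()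

perm-injective : (ρ ρ′ : Refl n) → perm ρ ≡ perm ρ′ → ρ ≡ ρ′
perm-injective ρ ρ′ eq = first-and-image-determine ρ ρ′ f≡f′ (begin
  image ρ                      ≡⟨ lookup-first ρ ⟨
  lookup (perm ρ) (first ρ)    ≡⟨ cong₂ lookup eq f≡f′ ⟩
  lookup (perm ρ′) (first ρ′)  ≡⟨ lookup-first ρ′ ⟩
  image ρ′                     ∎)
  where
  open ≡-Reasoning
  f≡f′ = perm-determines-first ρ ρ′ eq

InD-perm⇔Des : (w : Window n) (ρ : Refl n) → InD w (perm ρ) ⇔ Des w ρ
InD-perm⇔Des w ρ = mk⇔
  (λ { (ρ′ , ρ′≡ρ , des) → subst (Des w) (perm-injective ρ′ ρ ρ′≡ρ) des })
  (λ des → ρ , refl , des)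

evalW-pos : (w : Window n) (k : Fin n) → evalW w (pos k) ≡ lookup w k
evalW-pos {n} w k with toℕ k ℕ.<? n
... | yes k<n = cong (lookup w) (FinP.fromℕ<-toℕ k k<n)
... | no k≮n = ⊥-elim (k≮n (FinP.toℕ<n k))

evalW-neg : (w : Window n) (k : Fin n) → evalW w (- pos k) ≡ - lookup w k
evalW-neg {n} w k with toℕ k ℕ.<? n
... | yes k<n = cong (-_ ∘ lookup w) (FinP.fromℕ<-toℕ k k<n)
... | no k≮n = ⊥-elim (k≮n (FinP.toℕ<n k))

-- The window is explicit: evalW w (pos k) reduces to a stuck with-application, from which
-- Agda cannot recover w.
eval⁺ : (w : Window n) {k : Fin n} → lookup w k ≡ x → evalW w (pos k) ≡ x
eval⁺ w {k} = trans (evalW-pos w k)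

eval⁻ : (w : Window n) {k : Fin n} → lookup w k ≡ x → evalW w (- pos k) ≡ - x
eval⁻ w {k} wk≡x = trans (evalW-neg w k) (cong -_ wk≡x)

lookup-conj : (r τ : Refl n) (m : Fin n) →
              lookup (conj r τ) m ≡ evalW (perm τ) (evalW (perm r) (lookup (perm τ) m))
lookup-conj r τ m = trans (lookup-map m (evalW (perm τ)) (perm r · perm τ))
                          (cong (evalW (perm τ)) (lookup-map m (evalW (perm r)) (perm τ)))

conj-at : (τ r r′ : Refl n) (m : Fin n) {x y z : ℤ} →
          lookup (perm τ) m ≡ x → evalW (perm r) x ≡ y → evalW (perm τ) y ≡ z →
          lookup (perm r′) m ≡ z → lookup (conj r τ) m ≡ lookup (perm r′) m
conj-at τ r r′ m τm≡x rx≡y τy≡z r′m≡z =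
  trans (lookup-conj r τ m)
        (trans (cong (evalW (perm τ) ∘ evalW (perm r)) τm≡x)
               (trans (cong (evalW (perm τ)) rx≡y) (trans τy≡z (sym r′m≡z))))

conj≡perm : (τ r r′ : Refl n) (k a b : Fin n) →
  lookup (conj r τ) k ≡ lookup (perm r′) k →
  lookup (conj r τ) a ≡ lookup (perm r′) a →
  lookup (conj r τ) b ≡ lookup (perm r′) b →
  (∀ {m} → m ≢ k → m ≢ a → m ≢ b →
     lookup (perm τ) m ≡ pos m × lookup (perm r) m ≡ pos m × lookup (perm r′) m ≡ pos m) →
  conj r τ ≡ perm r′
conj≡perm τ r r′ k a b at-k at-a at-b fixed = lookup-ext (cover₃ _ k a b at-k at-a at-b fixed-elsewhere)
  where
  fixed-elsewhere : ∀ m → m ≢ k → m ≢ a → m ≢ b → lookup (conj r τ) m ≡ lookup (perm r′) m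
  fixed-elsewhere m m≢k m≢a m≢b with fixed m≢k m≢a m≢b
  ... | τm , rm , r′m = conj-at τ r r′ m τm (eval⁺ (perm r) rm) (eval⁺ (perm τ) τm) r′m

-- Ascents and descents

-- gap ρ x = ⟨x, −α_ρ⟩.
gap : Refl n → (Fin n → ℤ) → ℤ
gap (s i j _) x = x j - x i
gap (t i j _) x = x i + x j

asc⇔0<gap : (w : Window n) (ρ : Refl n) → Asc w ρ ⇔ 0ℤ < gap ρ (lookup w)
asc⇔0<gap w (s i j _) = x<y⇔0<y-x
asc⇔0<gap w (t i j _) = ⇔.refl

des⇔gap<0 : (w : Window n) (ρ : Refl n) → Des w ρ ⇔ gap ρ (lookup w) < 0ℤ
des⇔gap<0 w (s i j _) = x<y⇔x-y<0
des⇔gap<0 w (t i j _) = ⇔.refl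

AbsInjective : Window n → Set
AbsInjective w = ∀ i j → ∣ lookup w i ∣ ≡ ∣ lookup w j ∣ → i ≡ j

gap-nonzero : {w : Window n} → AbsInjective w → (ρ : Refl n) → gap ρ (lookup w) ≢ 0ℤ
gap-nonzero {w = w} inj (s i j i<j) wj-wi≡0 =
  >⇒≢ i<j (inj j i (cong ∣_∣ (ℤP.i-j≡0⇒i≡j (lookup w j) (lookup w i) wj-wi≡0)))
gap-nonzero {w = w} inj (t i j i<j) wi+wj≡0 =
  FinP.<⇒≢ i<j (inj i j (x+y≡0⇒∣x∣≡∣y∣ (lookup w i) (lookup w j) wi+wj≡0))

asc⊎des : {w : Window n} → AbsInjective w → (ρ : Refl n) → Asc w ρ ⊎ Des w ρ
asc⊎des {w = w} inj ρ with ℤP.<-cmp (gap ρ (lookup w)) 0ℤ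
... | tri< g<0 _ _ = inj₂ (Equivalence.from (des⇔gap<0 w ρ) g<0)
... | tri≈ _ g≡0 _ = ⊥-elim (gap-nonzero {w = w} inj ρ g≡0)
... | tri> _ _ 0<g = inj₁ (Equivalence.from (asc⇔0<gap w ρ) 0<g)

-- Roots

δ : Fin n → Fin n → ℤ
δ m k = lookup (e k) m

module _ {i j : Fin n} (i<j : i Fin.< j) (m : Fin n) where

  lookup-root-s : lookup (root (s i j i<j)) m ≡ δ m i - δ m j
  lookup-root-s = trans (lookup-zipWith _+_ m (e i) (⊖ e j)) (cong (_+_ (δ m i)) (lookup-map m -_ (e j)))

  lookup-root-t : lookup (root (t i j i<j)) m ≡ - δ m i - δ m j
  lookup-root-t = trans (lookup-zipWith _+_ m (⊖ e i) (⊖ e j))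
                        (cong₂ _+_ (lookup-map m -_ (e i)) (lookup-map m -_ (e j)))

lookup-root : (ρ : Refl n) (m : Fin n) → lookup (root ρ) m ≡ - gap ρ (δ m)
lookup-root (s i j i<j) m = trans (lookup-root-s i<j m) (sym (-[x-y]≡y-x (δ m j) (δ m i)))
  where
  -[x-y]≡y-x : ∀ x y → - (x - y) ≡ y - x
  -[x-y]≡y-x = solve-∀
lookup-root (t i j i<j) m = trans (lookup-root-t i<j m) (sym (ℤP.neg-distrib-+ (δ m i) (δ m j)))

SimpleCombination : (Fin n → ℤ) → Set
SimpleCombination {n} f =
  Σ (List (ℕ × Refl n)) λ cs → All (Simple ∘ proj₂) cs × (∀ m → lookup (lincomb cs) m ≡ f m)

lookup-lincomb-[] : (m : Fin n) → lookup (lincomb []) m ≡ 0ℤ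
lookup-lincomb-[] m = lookup-replicate m 0ℤ

lookup-lincomb-∷ : (c : ℕ) (ρ : Refl n) (cs : List (ℕ × Refl n)) (m : Fin n) →
                   lookup (lincomb ((c , ρ) ∷ cs)) m ≡ + c * lookup (root ρ) m + lookup (lincomb cs) m
lookup-lincomb-∷ c ρ cs m = trans (lookup-zipWith _+_ m (map (+ c *_) (root ρ)) (lincomb cs))
                                  (cong (_+ lookup (lincomb cs) m) (lookup-map m (+ c *_) (root ρ)))

lookup-lincomb-++ : (cs ds : List (ℕ × Refl n)) (m : Fin n) →
                    lookup (lincomb (cs ++ ds)) m ≡ lookup (lincomb cs) m + lookup (lincomb ds) m
lookup-lincomb-++ [] ds m rewrite lookup-lincomb-[] m = sym (ℤP.+-identityˡ (lookup (lincomb ds) m))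
lookup-lincomb-++ ((c , ρ) ∷ cs) ds m
  rewrite lookup-lincomb-∷ c ρ (cs ++ ds) m | lookup-lincomb-∷ c ρ cs m | lookup-lincomb-++ cs ds m =
  sym (ℤP.+-assoc (+ c * lookup (root ρ) m) (lookup (lincomb cs) m) (lookup (lincomb ds) m))

simple-combination : (ρ : Refl n) → Simple ρ → SimpleCombination (lookup (root ρ))
simple-combination ρ simple = (1 , ρ) ∷ [] , simple ∷ [] , λ m →
  trans (lookup-lincomb-∷ 1 ρ [] m)
        (trans (cong₂ _+_ (ℤP.*-identityˡ (lookup (root ρ) m)) (lookup-lincomb-[] m))
               (ℤP.+-identityʳ (lookup (root ρ) m)))

combination-+ : {f g : Fin n → ℤ} → SimpleCombination f → SimpleCombination g →
                SimpleCombination (λ m → f m + g m)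
combination-+ (cs , cs-simple , cs≡f) (ds , ds-simple , ds≡g) =
  cs ++ ds , ++⁺ cs-simple ds-simple , λ m → trans (lookup-lincomb-++ cs ds m) (cong₂ _+_ (cs≡f m) (ds≡g m))

combination-≗ : {f g : Fin n → ℤ} → (∀ m → f m ≡ g m) → SimpleCombination f → SimpleCombination g
combination-≗ f≗g (cs , cs-simple , cs≡f) = cs , cs-simple , λ m → trans (cs≡f m) (f≗g m)

difference-combination : (i j : Fin n) → toℕ i ℕ.≤ toℕ j → SimpleCombination (λ m → δ m i - δ m j)
difference-combination {n} i j i≤j = ladder (toℕ j ℕ.∸ toℕ i) i j (sym (ℕP.m∸n+n≡m i≤j))
  where
  ladder : (d : ℕ) (i j : Fin n) → toℕ j ≡ d ℕ.+ toℕ i → SimpleCombination (λ m → δ m i - δ m j)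
  ladder zero i j j≡i with FinP.toℕ-injective j≡i
  ... | refl = [] , [] , λ m → trans (lookup-lincomb-[] m) (sym (ℤP.+-inverseʳ (δ m i)))
  ladder (suc d) i j j≡1+d+i =
    combination-≗ (λ m → trans (cong (_+ (δ m i′ - δ m j)) (lookup-root-s i<i′ m))
                               (ℤP.+-minus-telescope (δ m i) (δ m i′) (δ m j)))
      (combination-+ (simple-combination (s i i′ i<i′) (FinP.toℕ-fromℕ< i′<n)) (ladder d i′ j j≡d+i′))
    where
    i′<n : suc (toℕ i) ℕ.< n
    i′<n = ℕP.≤-<-trans (subst (suc (toℕ i) ℕ.≤_) (sym j≡1+d+i) (s≤s (ℕP.m≤n+m (toℕ i) d))) (FinP.toℕ<n j)
    i′ : Fin n
    i′ = fromℕ< i′<n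
    i<i′ : i Fin.< i′
    i<i′ = ℕP.≤-reflexive (sym (FinP.toℕ-fromℕ< i′<n))
    j≡d+i′ : toℕ j ≡ d ℕ.+ toℕ i′
    j≡d+i′ = trans j≡1+d+i (trans (sym (ℕP.+-suc d (toℕ i))) (cong (d ℕ.+_) (sym (FinP.toℕ-fromℕ< i′<n))))

root-combination : (ρ : Refl n) → SimpleCombination (lookup (root ρ))
root-combination (s i j i<j) =
  combination-≗ (λ m → sym (lookup-root-s i<j m)) (difference-combination i j (ℕP.<⇒≤ i<j))
root-combination {suc (suc _)} (t i j i<j) =
  combination-≗ sum≡root
    (combination-+ (simple-combination β₀₁ (refl , refl))
      (combination-+ (difference-combination 0F i z≤n) (difference-combination 1F j 1≤j)))
  where
  β₀₁ = t 0F 1F (s≤s z≤n)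
  1≤j : 1 ℕ.≤ toℕ j
  1≤j = ℕP.≤-trans (s≤s z≤n) i<j
  -- −e_i − e_j = (−e_0 − e_1) + (e_0 − e_i) + (e_1 − e_j)
  regroup : ∀ x₀ x₁ xᵢ xⱼ → (- x₀ - x₁) + ((x₀ - xᵢ) + (x₁ - xⱼ)) ≡ - xᵢ - xⱼ
  regroup = solve-∀
  sum≡root : ∀ m → lookup (root β₀₁) m + ((δ m 0F - δ m i) + (δ m 1F - δ m j)) ≡ lookup (root (t i j i<j)) m
  sum≡root m = begin
    lookup (root β₀₁) m + ((δ m 0F - δ m i) + (δ m 1F - δ m j))
      ≡⟨ cong (_+ ((δ m 0F - δ m i) + (δ m 1F - δ m j))) (lookup-root-t {i = 0F} {1F} (s≤s z≤n) m) ⟩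
    (- δ m 0F - δ m 1F) + ((δ m 0F - δ m i) + (δ m 1F - δ m j))
      ≡⟨ regroup (δ m 0F) (δ m 1F) (δ m i) (δ m j) ⟩
    - δ m i - δ m j
      ≡⟨ lookup-root-t i<j m ⟨
    lookup (root (t i j i<j)) m ∎
    where open ≡-Reasoning
root-combination {suc zero} (t 0F 0F ())

⪯-of-gap-sum : (τ r r′ : Refl n) → (∀ x → gap τ x ≡ gap r x + gap r′ x) → r ⪯ τ
⪯-of-gap-sum τ r r′ gap-sum with root-combination r′
... | cs , cs-simple , cs≡r′ = cs , cs-simple , lookup-ext λ m → begin
  lookup (root τ ⊕ (⊖ root r)) m                     ≡⟨ lookup-zipWith _+_ m (root τ) (⊖ root r) ⟩
  lookup (root τ) m + lookup (⊖ root r) m            ≡⟨ cong₂ _+_ (lookup-root τ m)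
                                                           (trans (lookup-map m -_ (root r)) (cong -_ (lookup-root r m))) ⟩
  - gap τ (δ m) - - gap r (δ m)                      ≡⟨ cong (λ g → - g - - gap r (δ m)) (gap-sum (δ m)) ⟩
  - (gap r (δ m) + gap r′ (δ m)) - - gap r (δ m)     ≡⟨ cancel (gap r (δ m)) (gap r′ (δ m)) ⟩
  - gap r′ (δ m)                                     ≡⟨ lookup-root r′ m ⟨
  lookup (root r′) m                                 ≡⟨ cs≡r′ m ⟨
  lookup (lincomb cs) m                              ∎
  where
  open ≡-Reasoning
  cancel : ∀ x y → - (x + y) - - x ≡ - y
  cancel = solve-∀

-- Splitting the root of τ

-- r′ = r^τ, and α_τ = α_r + α_r′, expressed through the linear forms gap.
record Splitting (τ r r′ : Refl n) : Set where
  field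
    gap-sum : ∀ x → gap τ x ≡ gap r x + gap r′ x
    r′≢τ    : r′ ≢ τ
    conj≡   : conj r τ ≡ perm r′

module _ {a b k : Fin n} (a<b : a Fin.< b) (a<k : a Fin.< k) (k<b : k Fin.< b) where
  private
    a≢k = FinP.<⇒≢ a<k
    k≢a = >⇒≢ a<k
    k≢b = FinP.<⇒≢ k<b
    b≢k = >⇒≢ k<b
    a≢b = FinP.<⇒≢ a<b
    b≢a = >⇒≢ a<b

  αab≡αak+αkb : Splitting (s a b a<b) (s a k a<k) (s k b k<b)
  αab≡αak+αkb = record
    { gap-sum = λ x → identity (x a) (x b) (x k)
    ; r′≢τ    = λ { refl → FinP.<-irrefl refl a<k }
    ; conj≡   = conj≡perm τ r r′ k a b
        (at k (s-elsewhere a<b k≢a k≢b) (eval⁺ (perm r) (s-at₂ a<k)) (eval⁺ (perm τ) (s-at₁ a<b)) (s-at₁ k<b))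
        (at a (s-at₁ a<b) (eval⁺ (perm r) (s-elsewhere a<k b≢a b≢k)) (eval⁺ (perm τ) (s-at₂ a<b))
              (s-elsewhere k<b a≢k a≢b))
        (at b (s-at₂ a<b) (eval⁺ (perm r) (s-at₁ a<k)) (eval⁺ (perm τ) (s-elsewhere a<b k≢a k≢b)) (s-at₂ k<b))
        (λ m≢k m≢a m≢b → s-elsewhere a<b m≢a m≢b , s-elsewhere a<k m≢a m≢k , s-elsewhere k<b m≢k m≢b)
    }
    where
    τ = s a b a<b
    r = s a k a<k
    r′ = s k b k<b
    at = conj-at τ r r′
    identity : ∀ a b k → b - a ≡ (k - a) + (b - k)
    identity = solve-∀

  αab≡αkb+αak : Splitting (s a b a<b) (s k b k<b) (s a k a<k)
  αab≡αkb+αak = record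
    { gap-sum = λ x → identity (x a) (x b) (x k)
    ; r′≢τ    = λ { refl → FinP.<-irrefl refl k<b }
    ; conj≡   = conj≡perm τ r r′ k a b
        (at k (s-elsewhere a<b k≢a k≢b) (eval⁺ (perm r) (s-at₁ k<b)) (eval⁺ (perm τ) (s-at₂ a<b)) (s-at₂ a<k))
        (at a (s-at₁ a<b) (eval⁺ (perm r) (s-at₂ k<b)) (eval⁺ (perm τ) (s-elsewhere a<b k≢a k≢b)) (s-at₁ a<k))
        (at b (s-at₂ a<b) (eval⁺ (perm r) (s-elsewhere k<b a≢k a≢b)) (eval⁺ (perm τ) (s-at₁ a<b))
              (s-elsewhere a<k b≢a b≢k))
        (λ m≢k m≢a m≢b → s-elsewhere a<b m≢a m≢b , s-elsewhere k<b m≢k m≢b , s-elsewhere a<k m≢a m≢k)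
    }
    where
    τ = s a b a<b
    r = s k b k<b
    r′ = s a k a<k
    at = conj-at τ r r′
    identity : ∀ a b k → b - a ≡ (b - k) + (k - a)
    identity = solve-∀

  βab≡αkb+βak : Splitting (t a b a<b) (s k b k<b) (t a k a<k)
  βab≡αkb+βak = record
    { gap-sum = λ x → identity (x a) (x b) (x k)
    ; r′≢τ    = λ { refl → FinP.<-irrefl refl k<b }
    ; conj≡   = conj≡perm τ r r′ k a b
        (at k (t-elsewhere a<b k≢a k≢b) (eval⁺ (perm r) (s-at₁ k<b)) (eval⁺ (perm τ) (t-at₂ a<b)) (t-at₂ a<k))
        (at a (t-at₁ a<b) (eval⁻ (perm r) (s-at₂ k<b)) (eval⁻ (perm τ) (t-elsewhere a<b k≢a k≢b)) (t-at₁ a<k))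
        (at b (t-at₂ a<b) (eval⁻ (perm r) (s-elsewhere k<b a≢k a≢b)) (eval⁻ (perm τ) (t-at₁ a<b))
              (t-elsewhere a<k b≢a b≢k))
        (λ m≢k m≢a m≢b → t-elsewhere a<b m≢a m≢b , s-elsewhere k<b m≢k m≢b , t-elsewhere a<k m≢a m≢k)
    }
    where
    τ = t a b a<b
    r = s k b k<b
    r′ = t a k a<k
    at = conj-at τ r r′
    identity : ∀ a b k → a + b ≡ (b - k) + (a + k)
    identity = solve-∀

  βab≡βak+αkb : Splitting (t a b a<b) (t a k a<k) (s k b k<b)
  βab≡βak+αkb = record
    { gap-sum = λ x → identity (x a) (x b) (x k)
    ; r′≢τ    = λ ()
    ; conj≡   = conj≡perm τ r r′ k a b
        (at k (t-elsewhere a<b k≢a k≢b) (eval⁺ (perm r) (t-at₂ a<k)) (eval⁻ (perm τ) (t-at₁ a<b)) (s-at₁ k<b))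
        (at a (t-at₁ a<b) (eval⁻ (perm r) (t-elsewhere a<k b≢a b≢k)) (eval⁻ (perm τ) (t-at₂ a<b))
              (s-elsewhere k<b a≢k a≢b))
        (at b (t-at₂ a<b) (eval⁻ (perm r) (t-at₁ a<k)) (eval⁺ (perm τ) (t-elsewhere a<b k≢a k≢b)) (s-at₂ k<b))
        (λ m≢k m≢a m≢b → t-elsewhere a<b m≢a m≢b , t-elsewhere a<k m≢a m≢k , s-elsewhere k<b m≢k m≢b)
    }
    where
    τ = t a b a<b
    r = t a k a<k
    r′ = s k b k<b
    at = conj-at τ r r′
    identity : ∀ a b k → a + b ≡ (a + k) + (b - k)
    identity = solve-∀

module _ {a b k : Fin n} (a<b : a Fin.< b) (k<a : k Fin.< a) (k<b : k Fin.< b) where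
  private
    a≢k = >⇒≢ k<a
    k≢a = FinP.<⇒≢ k<a
    k≢b = FinP.<⇒≢ k<b
    b≢k = >⇒≢ k<b
    a≢b = FinP.<⇒≢ a<b
    b≢a = >⇒≢ a<b

  βab≡αka+βkb : Splitting (t a b a<b) (s k a k<a) (t k b k<b)
  βab≡αka+βkb = record
    { gap-sum = λ x → identity (x a) (x b) (x k)
    ; r′≢τ    = λ { refl → FinP.<-irrefl refl k<a }
    ; conj≡   = conj≡perm τ r r′ k a b
        (at k (t-elsewhere a<b k≢a k≢b) (eval⁺ (perm r) (s-at₁ k<a)) (eval⁺ (perm τ) (t-at₁ a<b)) (t-at₁ k<b))
        (at a (t-at₁ a<b) (eval⁻ (perm r) (s-elsewhere k<a b≢k b≢a)) (eval⁻ (perm τ) (t-at₂ a<b))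
              (t-elsewhere k<b a≢k a≢b))
        (at b (t-at₂ a<b) (eval⁻ (perm r) (s-at₂ k<a)) (eval⁻ (perm τ) (t-elsewhere a<b k≢a k≢b)) (t-at₂ k<b))
        (λ m≢k m≢a m≢b → t-elsewhere a<b m≢a m≢b , s-elsewhere k<a m≢k m≢a , t-elsewhere k<b m≢k m≢b)
    }
    where
    τ = t a b a<b
    r = s k a k<a
    r′ = t k b k<b
    at = conj-at τ r r′
    identity : ∀ a b k → a + b ≡ (a - k) + (k + b)
    identity = solve-∀

  βab≡βkb+αka : Splitting (t a b a<b) (t k b k<b) (s k a k<a)
  βab≡βkb+αka = record
    { gap-sum = λ x → identity (x a) (x b) (x k)
    ; r′≢τ    = λ ()
    ; conj≡   = conj≡perm τ r r′ k a b
        (at k (t-elsewhere a<b k≢a k≢b) (eval⁺ (perm r) (t-at₁ k<b)) (eval⁻ (perm τ) (t-at₂ a<b)) (s-at₁ k<a))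
        (at a (t-at₁ a<b) (eval⁻ (perm r) (t-at₂ k<b)) (eval⁺ (perm τ) (t-elsewhere a<b k≢a k≢b)) (s-at₂ k<a))
        (at b (t-at₂ a<b) (eval⁻ (perm r) (t-elsewhere k<b a≢k a≢b)) (eval⁻ (perm τ) (t-at₁ a<b))
              (s-elsewhere k<a b≢k b≢a))
        (λ m≢k m≢a m≢b → t-elsewhere a<b m≢a m≢b , t-elsewhere k<b m≢k m≢b , s-elsewhere k<a m≢k m≢a)
    }
    where
    τ = t a b a<b
    r = t k b k<b
    r′ = s k a k<a
    at = conj-at τ r r′
    identity : ∀ a b k → a + b ≡ (k + b) + (a - k)
    identity = solve-∀

  βab≡αkb+βka : Splitting (t a b a<b) (s k b k<b) (t k a k<a)
  βab≡αkb+βka = record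
    { gap-sum = λ x → identity (x a) (x b) (x k)
    ; r′≢τ    = λ { refl → FinP.<-irrefl refl k<a }
    ; conj≡   = conj≡perm τ r r′ k a b
        (at k (t-elsewhere a<b k≢a k≢b) (eval⁺ (perm r) (s-at₁ k<b)) (eval⁺ (perm τ) (t-at₂ a<b)) (t-at₁ k<a))
        (at a (t-at₁ a<b) (eval⁻ (perm r) (s-at₂ k<b)) (eval⁻ (perm τ) (t-elsewhere a<b k≢a k≢b)) (t-at₂ k<a))
        (at b (t-at₂ a<b) (eval⁻ (perm r) (s-elsewhere k<b a≢k a≢b)) (eval⁻ (perm τ) (t-at₁ a<b))
              (t-elsewhere k<a b≢k b≢a))
        (λ m≢k m≢a m≢b → t-elsewhere a<b m≢a m≢b , s-elsewhere k<b m≢k m≢b , t-elsewhere k<a m≢k m≢a)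
    }
    where
    τ = t a b a<b
    r = s k b k<b
    r′ = t k a k<a
    at = conj-at τ r r′
    identity : ∀ a b k → a + b ≡ (b - k) + (k + a)
    identity = solve-∀

  βab≡βka+αkb : Splitting (t a b a<b) (t k a k<a) (s k b k<b)
  βab≡βka+αkb = record
    { gap-sum = λ x → identity (x a) (x b) (x k)
    ; r′≢τ    = λ ()
    ; conj≡   = conj≡perm τ r r′ k a b
        (at k (t-elsewhere a<b k≢a k≢b) (eval⁺ (perm r) (t-at₁ k<a)) (eval⁻ (perm τ) (t-at₁ a<b)) (s-at₁ k<b))
        (at a (t-at₁ a<b) (eval⁻ (perm r) (t-elsewhere k<a b≢k b≢a)) (eval⁻ (perm τ) (t-at₂ a<b))
              (s-elsewhere k<b a≢k a≢b))
        (at b (t-at₂ a<b) (eval⁻ (perm r) (t-at₂ k<a)) (eval⁺ (perm τ) (t-elsewhere a<b k≢a k≢b)) (s-at₂ k<b))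
        (λ m≢k m≢a m≢b → t-elsewhere a<b m≢a m≢b , t-elsewhere k<a m≢k m≢a , s-elsewhere k<b m≢k m≢b)
    }
    where
    τ = t a b a<b
    r = t k a k<a
    r′ = s k b k<b
    at = conj-at τ r r′
    identity : ∀ a b k → a + b ≡ (k + a) + (b - k)
    identity = solve-∀

module _ {a b : Fin n} (a<b : a Fin.< b) where

  s-s-descent-splits : {i j : Fin n} (i<j : i Fin.< j) →
    SwitchView a b (pos b) (pos a) i x → SwitchView a b (pos b) (pos a) j y → y < x →
    s i j i<j ≢ s a b a<b → ∃ (Splitting (s a b a<b) (s i j i<j))
  s-s-descent-splits i<j at₁ at₁ _ _ = ⊥-elim (FinP.<-irrefl refl i<j)
  s-s-descent-splits i<j at₁ at₂ _ r≢τ = ⊥-elim (r≢τ (cong (s a b) (FinP.<-irrelevant i<j a<b)))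
  s-s-descent-splits i<j at₁ (elsewhere _ _) d _ = _ , αab≡αak+αkb a<b i<j (pos-cancel-< d)
  s-s-descent-splits i<j at₂ at₁ _ _ = ⊥-elim (FinP.<-asym a<b i<j)
  s-s-descent-splits i<j at₂ at₂ _ _ = ⊥-elim (FinP.<-irrefl refl i<j)
  s-s-descent-splits i<j at₂ (elsewhere _ _) d _ = ⊥-elim (FinP.<-asym (FinP.<-trans a<b i<j) (pos-cancel-< d))
  s-s-descent-splits i<j (elsewhere _ _) at₁ d _ = ⊥-elim (FinP.<-asym (FinP.<-trans i<j a<b) (pos-cancel-< d))
  s-s-descent-splits i<j (elsewhere _ _) at₂ d _ = _ , αab≡αkb+αak a<b (pos-cancel-< d) i<j
  s-s-descent-splits i<j (elsewhere _ _) (elsewhere _ _) d _ = ⊥-elim (FinP.<-asym i<j (pos-cancel-< d))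

  s-entries-positive : {m : Fin n} → SwitchView a b (pos b) (pos a) m x → 0ℤ < x
  s-entries-positive at₁ = ℤ.+<+ (s≤s z≤n)
  s-entries-positive at₂ = ℤ.+<+ (s≤s z≤n)
  s-entries-positive (elsewhere _ _) = ℤ.+<+ (s≤s z≤n)

  t-s-descent-splits : {i j : Fin n} (i<j : i Fin.< j) →
    SwitchView a b (- pos b) (- pos a) i x → SwitchView a b (- pos b) (- pos a) j y → y < x →
    ∃ (Splitting (t a b a<b) (s i j i<j))
  t-s-descent-splits i<j at₁ at₁ _ = ⊥-elim (FinP.<-irrefl refl i<j)
  t-s-descent-splits i<j at₁ at₂ d = ⊥-elim (FinP.<-asym a<b (ℤP.drop‿-<- d))
  t-s-descent-splits i<j at₁ (elsewhere _ _) ()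
  t-s-descent-splits i<j at₂ at₁ _ = ⊥-elim (FinP.<-asym a<b i<j)
  t-s-descent-splits i<j at₂ at₂ _ = ⊥-elim (FinP.<-irrefl refl i<j)
  t-s-descent-splits i<j at₂ (elsewhere _ _) ()
  t-s-descent-splits i<j (elsewhere _ _) at₁ _ = _ , βab≡αka+βkb a<b i<j (FinP.<-trans i<j a<b)
  t-s-descent-splits {i = i} i<j (elsewhere i≢a _) at₂ _ with FinP.<-cmp i a
  ... | tri< i<a _ _ = _ , βab≡αkb+βka a<b i<a i<j
  ... | tri≈ _ i≡a _ = ⊥-elim (i≢a i≡a)
  ... | tri> _ _ a<i = _ , βab≡αkb+βak a<b a<i i<j
  t-s-descent-splits i<j (elsewhere _ _) (elsewhere _ _) d = ⊥-elim (FinP.<-asym i<j (pos-cancel-< d))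

  t-t-descent-splits : {i j : Fin n} (i<j : i Fin.< j) →
    SwitchView a b (- pos b) (- pos a) i x → SwitchView a b (- pos b) (- pos a) j y → x + y < 0ℤ →
    t i j i<j ≢ t a b a<b → ∃ (Splitting (t a b a<b) (t i j i<j))
  t-t-descent-splits i<j at₁ at₁ _ _ = ⊥-elim (FinP.<-irrefl refl i<j)
  t-t-descent-splits i<j at₁ at₂ _ r≢τ = ⊥-elim (r≢τ (cong (t a b) (FinP.<-irrelevant i<j a<b)))
  t-t-descent-splits i<j at₁ (elsewhere _ _) d _ = _ , βab≡βak+αkb a<b i<j (-pos+pos<0⇒> d)
  t-t-descent-splits i<j at₂ at₁ _ _ = ⊥-elim (FinP.<-asym a<b i<j)
  t-t-descent-splits i<j at₂ at₂ _ _ = ⊥-elim (FinP.<-irrefl refl i<j)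
  t-t-descent-splits i<j at₂ (elsewhere _ _) d _ = ⊥-elim (FinP.<-asym (FinP.<-trans a<b i<j) (-pos+pos<0⇒> d))
  t-t-descent-splits i<j (elsewhere _ _) at₁ _ _ = _ , βab≡βka+αkb a<b i<j (FinP.<-trans i<j a<b)
  t-t-descent-splits i<j (elsewhere _ _) at₂ d _ = _ , βab≡βkb+αka a<b (pos-pos<0⇒< d) i<j
  t-t-descent-splits i<j (elsewhere _ _) (elsewhere _ _) (ℤ.+<+ ()) _

descent-splits : (τ r : Refl n) → Des (perm τ) r → r ≢ τ → ∃ (Splitting τ r)
descent-splits (s a b a<b) (s i j i<j) d = s-s-descent-splits a<b i<j (s-view a<b i) (s-view a<b j) d
descent-splits (s a b a<b) (t i j i<j) d _ = ⊥-elim (ℤP.<-asym d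
  (ℤP.+-mono-< (s-entries-positive a<b (s-view a<b i)) (s-entries-positive a<b (s-view a<b j))))
descent-splits (t a b a<b) (s i j i<j) d _ = t-s-descent-splits a<b i<j (t-view a<b i) (t-view a<b j) d
descent-splits (t a b a<b) (t i j i<j) d = t-t-descent-splits a<b i<j (t-view a<b i) (t-view a<b j) d

module _ {τ r r′ : Refl n} (sp : Splitting τ r r′) where
  open Splitting sp

  summands-∉AD : {u v : Window n} → (∀ ρ → InAD u v ρ → ρ ⪯ τ → ρ ≡ τ) → r ≢ τ →
                 ¬ InAD u v r × ¬ InAD u v r′
  summands-∉AD minimal r≢τ =
      (λ r∈AD → r≢τ (minimal r r∈AD (⪯-of-gap-sum τ r r′ gap-sum)))
    , (λ r′∈AD → r′≢τ (minimal r′ r′∈AD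
         (⪯-of-gap-sum τ r′ r (λ x → trans (gap-sum x) (ℤP.+-comm (gap r x) (gap r′ x))))))

  asc-of-splitting : (w : Window n) → Asc w τ → Des w r′ → Asc w r
  asc-of-splitting w asc-τ des-r′ = Equivalence.from (asc⇔0<gap w r)
    (0<x+y⇒y<0⇒0<x (subst (0ℤ <_) (gap-sum (lookup w)) (Equivalence.to (asc⇔0<gap w τ) asc-τ))
                   (Equivalence.to (des⇔gap<0 w r′) des-r′))

  des-of-splitting : (w : Window n) → Des w τ → Asc w r → Des w r′
  des-of-splitting w des-τ asc-r = Equivalence.from (des⇔gap<0 w r′)
    (x+y<0⇒0<x⇒y<0 (subst (_< 0ℤ) (gap-sum (lookup w)) (Equivalence.to (des⇔gap<0 w τ) des-τ))
                   (Equivalence.to (asc⇔0<gap w r) asc-r))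

  InD-conj⇔Des : (w : Window n) → InD w (conj r τ) ⇔ Des w r′
  InD-conj⇔Des w = subst (λ c → InD w c ⇔ Des w r′) (sym conj≡) (InD-perm⇔Des w r′)

module _ {u v : Window n} {ρ : Refl n} (ρ∉AD : ¬ InAD u v ρ) where

  asc-transfer : AbsInjective v → Asc u ρ → Asc v ρ
  asc-transfer v-inj asc-u = [ id , (λ des-v → ⊥-elim (ρ∉AD (asc-u , des-v))) ]′ (asc⊎des v-inj ρ)

  des-transfer : AbsInjective u → Des v ρ → Des u ρ
  des-transfer u-inj des-v = [ (λ asc-u → ⊥-elim (ρ∉AD (asc-u , des-v))) , id ]′ (asc⊎des u-inj ρ)

⇔-cycle : {A B C D : Set} → (A → B) → (B → C) → (C → D) → (D → A) → (A ⇔ B) × (B ⇔ C) × (C ⇔ D)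
⇔-cycle f g h k = mk⇔ f (k ∘ h ∘ g) , mk⇔ g (f ∘ k ∘ h) , mk⇔ h (g ∘ f ∘ k)

theorem3p6 : (n : ℕ) (u v : Window n) → InDn n u → InDn n v →
    (τ : Refl n) → MinimalAD u v τ →
    (r : Refl n) → Des (perm τ) r → r ≢ τ →
    (Asc u r ⇔ Asc v r) × (Asc v r ⇔ InD v (conj r τ)) × (InD v (conj r τ) ⇔ InD u (conj r τ))
theorem3p6 n u v (_ , u-inj , _) (_ , v-inj , _) τ ((asc-u-τ , des-v-τ) , minimal) r des-τ-r r≢τ
  with descent-splits τ r des-τ-r r≢τ
... | r′ , sp with summands-∉AD sp minimal r≢τ
...   | r∉AD , r′∉AD = ⇔-cycle
  (asc-transfer r∉AD v-inj)
  (from (InD-conj⇔Des sp v) ∘ des-of-splitting sp v des-v-τ)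
  (from (InD-conj⇔Des sp u) ∘ des-transfer r′∉AD u-inj ∘ to (InD-conj⇔Des sp v))
  (asc-of-splitting sp u asc-u-τ ∘ to (InD-conj⇔Des sp u))
  where open Equivalence
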